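{- Let $n>3$ and let $X_n$ be the pairs graph defined in the context. Then the least eigenvalue of the adjacency matrix of $X_n$ is at least $-(n-3)$.
   Context: For $n>3$, the pairs graph $X_n$ is the graph whose vertices are the ordered pairs $(i,j)$ with $i,j\in\{1,\dots,n-1\}$ and $i\neq j$; two vertices $(i,j)$ and $(k,l)$ are adjacent if and only if either $\{i,j\}\cap\{k,l\}=\emptyset$, or ($i=l$ and $j\neq k$), or ($i\neq l$ and $j=k$). (It is regular of valency $(n-2)(n-3)$.) Eigenvalues of a graph are those of its adjacency matrix. -}

module Defs where

open import Level using (Level; _⊔_; suc)
open import Data.Nat using (ℕ; zero; suc)
open import Data.Fin using (Fin; _≟_)
open import Data.Fin.Properties using ()
open import Data.Product using (Σ; Σ-syntax; _×_; _,_; proj₁; proj₂; ∃-syntax)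
open import Data.Sum using (_⊎_)
open import Data.List using (List; []; _∷_; foldr; map; concatMap; allFin)
open import Data.Maybe using (Maybe; just; nothing)
open import Data.List using (mapMaybe)
open import Relation.Nullary using (¬_; Dec; yes; no)
open import Relation.Nullary.Decidable using (_×-dec_; _⊎-dec_; ¬?)
open import Relation.Binary.PropositionalEquality using (_≡_; _≢_)
open import Algebra.Bundles using (CommutativeRing)

record OrderedField (c ℓ₁ ℓ₂ : Level) : Set (Level.suc (c ⊔ ℓ₁ ⊔ ℓ₂)) where
  field
    commutativeRing : CommutativeRing c ℓ₁
  open CommutativeRing commutativeRing public
  field
    0≉1      : ¬ (0# ≈ 1#)
    inverse  : ∀ x → ¬ (x ≈ 0#) → Σ[ y ∈ Carrier ] (x * y ≈ 1#)
    _≤_      : Carrier → Carrier → Set ℓ₂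
    ≤-resp-≈ : ∀ {x x′ y y′} → x ≈ x′ → y ≈ y′ → x ≤ y → x′ ≤ y′
    ≤-refl   : ∀ {x} → x ≤ x
    ≤-trans  : ∀ {x y z} → x ≤ y → y ≤ z → x ≤ z
    ≤-antisym : ∀ {x y} → x ≤ y → y ≤ x → x ≈ y
    ≤-total  : ∀ x y → (x ≤ y) ⊎ (y ≤ x)
    +-mono-≤ : ∀ {x y} z → x ≤ y → (x + z) ≤ (y + z)
    *-nonneg : ∀ {x y} → 0# ≤ x → 0# ≤ y → 0# ≤ (x * y)

-- The pairs graph X_n, for m = n - 1: vertices are ordered pairs (i , j)
-- of elements of Fin m (standing for {1,…,n-1}) with i ≠ j.

Vertex : ℕ → Set
Vertex m = Σ[ p ∈ Fin m × Fin m ] (proj₁ p ≢ proj₂ p)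

Adjacent : ∀ {m} → Vertex m → Vertex m → Set
Adjacent ((i , j) , _) ((k , l) , _) =
  ((i ≢ k × i ≢ l) × (j ≢ k × j ≢ l))
  ⊎ ((i ≡ l × j ≢ k) ⊎ (i ≢ l × j ≡ k))

adjacent? : ∀ {m} (u v : Vertex m) → Dec (Adjacent u v)
adjacent? ((i , j) , _) ((k , l) , _) =
  ((¬? (i ≟ k) ×-dec ¬? (i ≟ l)) ×-dec (¬? (j ≟ k) ×-dec ¬? (j ≟ l)))
  ⊎-dec ((i ≟ l ×-dec ¬? (j ≟ k)) ⊎-dec (¬? (i ≟ l) ×-dec j ≟ k))

vertices : (m : ℕ) → List (Vertex m)
vertices m = concatMap (λ i → mapMaybe (pick i) (allFin m)) (allFin m)
  where
  pick : Fin m → Fin m → Maybe (Vertex m)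
  pick i j with i ≟ j
  ... | yes _ = nothing
  ... | no i≢j = just ((i , j) , i≢j)

module _ {c ℓ₁ ℓ₂} (F : OrderedField c ℓ₁ ℓ₂) where
  open OrderedField F

  adjMatrix : ∀ {m} → Vertex m → Vertex m → Carrier
  adjMatrix u v with adjacent? u v
  ... | yes _ = 1#
  ... | no _  = 0#

  sumV : ∀ m → (Vertex m → Carrier) → Carrier
  sumV m f = foldr _+_ 0# (map f (vertices m))

  IsAdjEigenvalue : (m : ℕ) → Carrier → Set (c ⊔ ℓ₁)
  IsAdjEigenvalue m λ′ =
    Σ[ x ∈ (Vertex m → Carrier) ]
      ((∃[ v ] ¬ (x v ≈ 0#)) ×
       (∀ u → sumV m (λ v → adjMatrix u v * x v) ≈ λ′ * x u))

  fromℕ : ℕ → Carrier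
  fromℕ zero    = 0#
  fromℕ (suc k) = 1# + fromℕ k

module Submission where

open import Data.Bool using (if_then_else_)
open import Data.Empty using (⊥-elim)
open import Data.Fin as Fin using (Fin; _≟_)
open import Data.List using (List; []; _∷_; _++_; foldr; map; concatMap; mapMaybe; allFin; tabulate)
import Data.List.Properties as List
open import Data.Maybe using (Maybe; just; nothing; maybe′)
open import Data.Nat as ℕ using (ℕ; zero; suc; _<_; _∸_; s≤s)
open import Data.Product using (_,_; Σ-syntax)
open import Data.Sum using (inj₁; inj₂)
open import Data.Vec.Functional using (transpose)
open import Function using (_∘_)
open import Relation.Binary.PropositionalEquality as ≡ using (_≡_; _≢_)
open import Relation.Nullary using (¬_; does; yes; no)
open import Defs

-- Write an eigenvector x as the matrix X with X i j = x (i , j) and zero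
-- diagonal, with row sums R, column sums C and total S.  Since
-- A (i,j) (k,l) = 1 - [i=k] - [j=l] - [i=l][j=k] + [i=k][j=l], the eigenvalue
-- equation at (i,j) reads  λ X i j + R i + C j + X j i = S + X i j.
-- Summing over j gives (λ + c) R i = c S with c = n - 3, likewise for the
-- columns, and summing once more (λ + c) S = (n - 1) c S.  If λ ≤ -c, then
-- S = 0, hence (λ + c) R = (λ + c) C = 0, and the equations at (i,j) and (j,i)
-- multiplied by λ + c form a 2×2 system of determinant λ (λ - 2) ≠ 0, so
-- (λ + c) X = 0 and λ = -c.  Proving λ + c = 0 in that case, instead of
-- deriving a contradiction, keeps the argument constructive.

-- Defs keeps the selector behind vertices local; unification recovers it from
-- the defining equation.
selectorOf : ∀ {m} {p : Fin m → Fin m → Maybe (Vertex m)} →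
  vertices m ≡ concatMap (λ i → mapMaybe (p i) (allFin m)) (allFin m) →
  Fin m → Fin m → Maybe (Vertex m)
selectorOf {p = p} _ = p

select : ∀ m → Fin m → Fin m → Maybe (Vertex m)
select m = selectorOf ≡.refl

δ : ∀ {m} → Fin m → Fin m → ℕ
δ i k = if does (i ≟ k) then 1 else 0

adjacency : ∀ {m} → Vertex m → Vertex m → ℕ
adjacency u v with adjacent? u v
... | yes _ = 1
... | no _  = 0

adjacency+δ+δ+δδ≡1+δδ : ∀ {m} {i j k l : Fin m} (i≢j : i ≢ j) (k≢l : k ≢ l) →
  adjacency ((i , j) , i≢j) ((k , l) , k≢l) ℕ.+ (δ i k ℕ.+ δ j l ℕ.+ δ i l ℕ.* δ j k)
    ≡ 1 ℕ.+ δ j l ℕ.* δ i k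
adjacency+δ+δ+δδ≡1+δδ {i = i} {j} {k} {l} i≢j k≢l with i ≟ k | j ≟ l | i ≟ l | j ≟ k
... | no _       | no _       | no _       | no _       = ≡.refl
... | yes _      | no _       | no _       | no _       = ≡.refl
... | no _       | yes _      | no _       | no _       = ≡.refl
... | no _       | no _       | yes _      | no _       = ≡.refl
... | no _       | no _       | no _       | yes _      = ≡.refl
... | yes _      | yes _      | no _       | no _       = ≡.refl
... | no _       | no _       | yes _      | yes _      = ≡.refl
... | yes ≡.refl | _          | yes ≡.refl | _          = ⊥-elim (k≢l ≡.refl)
... | _          | yes ≡.refl | _          | yes ≡.refl = ⊥-elim (k≢l ≡.refl)
... | yes ≡.refl | _          | _          | yes ≡.refl = ⊥-elim (i≢j ≡.refl)
... | _          | yes ≡.refl | yes ≡.refl | _          = ⊥-elim (i≢j ≡.refl)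

module _ {c ℓ₁ ℓ₂} (F : OrderedField c ℓ₁ ℓ₂) where
  open OrderedField F hiding (zero)
  open import Algebra.Properties.Ring ring
    using (-1*x≈-x; -‿involutive; [y-z]x≈yx-zx; x∙y⁻¹≈ε⇒x≈y; x≈y⇒x∙y⁻¹≈ε; +-cancelʳ; +-inverseˡ-unique)
  open import Algebra.Properties.Semiring.Mult semiring
    using (_×_; ×-congʳ; ×-congˡ; ×-homo-+; ×-assocˡ; ×-assoc-*; ×1-homo-*)
  open import Algebra.Properties.Semiring.Sum semiring
    using (sum-syntax; sum-cong-≋; sum-replicate; sum-replicate-zero; ∑-distrib-+; ∑-comm; *-distribˡ-sum)
  open import Algebra.Solver.CommutativeMonoid +-commutativeMonoid using (solve; _⊕_; _⊜_; id)
  open import Relation.Binary.Reasoning.Setoid setoid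

  x≉y∧xz≈yz⇒z≈0 : ∀ {x y z} → ¬ x ≈ y → x * z ≈ y * z → z ≈ 0#
  x≉y∧xz≈yz⇒z≈0 {x} {y} {z} x≉y xz≈yz with inverse (x - y) (x≉y ∘ x∙y⁻¹≈ε⇒x≈y x y)
  ... | w , [x-y]w≈1 = begin
    z                    ≈⟨ *-identityˡ z ⟨
    1# * z               ≈⟨ *-congʳ [x-y]w≈1 ⟨
    (x - y) * w * z      ≈⟨ *-congʳ (*-comm (x - y) w) ⟩
    w * (x - y) * z      ≈⟨ *-assoc w (x - y) z ⟩
    w * ((x - y) * z)    ≈⟨ *-congˡ ([y-z]x≈yx-zx z x y) ⟩
    w * (x * z - y * z)  ≈⟨ *-congˡ (x≈y⇒x∙y⁻¹≈ε xz≈yz) ⟩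
    w * 0#               ≈⟨ zeroʳ w ⟩
    0#                   ∎

  0≤1 : 0# ≤ 1#
  0≤1 with ≤-total 0# 1#
  ... | inj₁ 0≤1 = 0≤1
  ... | inj₂ 1≤0 = ≤-resp-≈ refl [-1][-1]≈1 (*-nonneg 0≤-1 0≤-1)
    where
    0≤-1 : 0# ≤ (- 1#)
    0≤-1 = ≤-resp-≈ (-‿inverseʳ 1#) (+-identityˡ (- 1#)) (+-mono-≤ (- 1#) 1≤0)
    [-1][-1]≈1 : - 1# * - 1# ≈ 1#
    [-1][-1]≈1 = trans (-1*x≈-x (- 1#)) (-‿involutive 1#)

  +-nonneg : ∀ {x y} → 0# ≤ x → 0# ≤ y → 0# ≤ (x + y)
  +-nonneg {x} {y} 0≤x 0≤y = ≤-trans 0≤x (≤-resp-≈ (+-identityˡ x) (+-comm y x) (+-mono-≤ x 0≤y))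

  x≤0∧0≤y⇒x≉1+y : ∀ {x y} → x ≤ 0# → 0# ≤ y → ¬ x ≈ 1# + y
  x≤0∧0≤y⇒x≉1+y {x} {y} x≤0 0≤y x≈1+y = 0≉1 (≤-antisym 0≤1 1≤0)
    where
    1≤0 : 1# ≤ 0#
    1≤0 = ≤-trans (≤-resp-≈ (+-identityˡ 1#) (+-comm y 1#) (+-mono-≤ 1# 0≤y))
                  (≤-resp-≈ x≈1+y refl x≤0)

  0≤fromℕ : ∀ n → 0# ≤ fromℕ F n
  0≤fromℕ zero    = ≤-refl
  0≤fromℕ (suc n) = +-nonneg 0≤1 (0≤fromℕ n)

  fromℕ≈×1 : ∀ n → fromℕ F n ≈ n × 1#
  fromℕ≈×1 zero    = refl
  fromℕ≈×1 (suc n) = +-congˡ (fromℕ≈×1 n)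

  fromℕ-homo-* : ∀ m n → fromℕ F (m ℕ.* n) ≈ fromℕ F m * fromℕ F n
  fromℕ-homo-* m n = begin
    fromℕ F (m ℕ.* n)      ≈⟨ fromℕ≈×1 (m ℕ.* n) ⟩
    (m ℕ.* n) × 1#         ≈⟨ ×1-homo-* m n ⟩
    (m × 1#) * (n × 1#)    ≈⟨ *-cong (fromℕ≈×1 m) (fromℕ≈×1 n) ⟨
    fromℕ F m * fromℕ F n  ∎

  fromℕ-*ˡ : ∀ n x → fromℕ F n * x ≈ n × x
  fromℕ-*ˡ n x = begin
    fromℕ F n * x  ≈⟨ *-congʳ (fromℕ≈×1 n) ⟩
    (n × 1#) * x   ≈⟨ ×-assoc-* n 1# x ⟩
    n × (1# * x)   ≈⟨ ×-congʳ n (*-identityˡ x) ⟩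
    n × x          ∎

  ×-zeroʳ : ∀ n → n × 0# ≈ 0#
  ×-zeroʳ n = trans (sym (sum-replicate n)) (sum-replicate-zero n)

  ∑-δ : ∀ {m} (i : Fin m) (f : Fin m → Carrier) → ∑[ k < m ] (δ i k × f k) ≈ f i
  ∑-δ {suc m} Fin.zero f = begin
    (f Fin.zero + 0#) + ∑[ k < m ] 0#  ≈⟨ +-cong (+-identityʳ _) (sum-replicate-zero m) ⟩
    f Fin.zero + 0#                    ≈⟨ +-identityʳ _ ⟩
    f Fin.zero                         ∎
  ∑-δ {suc m} (Fin.suc i) f = trans (+-identityˡ _) (∑-δ i (f ∘ Fin.suc))

  module _ {m : ℕ} where

    rowSum : (Fin m → Fin m → Carrier) → Fin m → Carrier
    rowSum Y i = ∑[ j < m ] Y i j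

    colSum : (Fin m → Fin m → Carrier) → Fin m → Carrier
    colSum Y j = ∑[ i < m ] Y i j

    total : (Fin m → Fin m → Carrier) → Carrier
    total Y = ∑[ i < m ] rowSum Y i

    total-transpose : ∀ Y → total (transpose Y) ≈ total Y
    total-transpose Y = ∑-comm (λ i j → Y j i)

    ∑∑-distrib-+ : (f g : Fin m → Fin m → Carrier) →
      ∑[ k < m ] ∑[ l < m ] (f k l + g k l) ≈ ∑[ k < m ] ∑[ l < m ] f k l + ∑[ k < m ] ∑[ l < m ] g k l
    ∑∑-distrib-+ f g =
      trans (sum-cong-≋ (λ k → ∑-distrib-+ (f k) (g k)))
            (∑-distrib-+ (λ k → ∑[ l < m ] f k l) (λ k → ∑[ l < m ] g k l))

    ∑∑-δ+δ+δδ : ∀ (Y : Fin m → Fin m → Carrier) i j →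
      ∑[ k < m ] ∑[ l < m ] ((δ i k ℕ.+ δ j l ℕ.+ δ i l ℕ.* δ j k) × Y k l)
        ≈ rowSum Y i + colSum Y j + Y j i
    ∑∑-δ+δ+δδ Y i j = begin
      ∑[ k < m ] ∑[ l < m ] ((δ i k ℕ.+ δ j l ℕ.+ δ i l ℕ.* δ j k) × Y k l)
        ≈⟨ sum-cong-≋ (λ k → sum-cong-≋ (λ l → expand k l)) ⟩
      ∑[ k < m ] ∑[ l < m ] (δ i k × Y k l + δ j l × Y k l + δ i l × (δ j k × Y k l))
        ≈⟨ trans (∑∑-distrib-+ (λ k l → δ i k × Y k l + δ j l × Y k l) (λ k l → δ i l × (δ j k × Y k l)))
                 (+-congʳ (∑∑-distrib-+ (λ k l → δ i k × Y k l) (λ k l → δ j l × Y k l))) ⟩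
      ∑[ k < m ] ∑[ l < m ] (δ i k × Y k l) + ∑[ k < m ] ∑[ l < m ] (δ j l × Y k l)
        + ∑[ k < m ] ∑[ l < m ] (δ i l × (δ j k × Y k l))
        ≈⟨ +-cong (+-cong rows cols) transposed ⟩
      rowSum Y i + colSum Y j + Y j i ∎
      where
      expand : ∀ k l → (δ i k ℕ.+ δ j l ℕ.+ δ i l ℕ.* δ j k) × Y k l
                         ≈ δ i k × Y k l + δ j l × Y k l + δ i l × (δ j k × Y k l)
      expand k l = trans (×-homo-+ (Y k l) (δ i k ℕ.+ δ j l) (δ i l ℕ.* δ j k))
                         (+-cong (×-homo-+ (Y k l) (δ i k) (δ j l)) (sym (×-assocˡ (Y k l) (δ i l) (δ j k))))
      rows : ∑[ k < m ] ∑[ l < m ] (δ i k × Y k l) ≈ rowSum Y i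
      rows = trans (∑-comm (λ k l → δ i k × Y k l)) (sum-cong-≋ (λ l → ∑-δ i (λ k → Y k l)))
      cols : ∑[ k < m ] ∑[ l < m ] (δ j l × Y k l) ≈ colSum Y j
      cols = sum-cong-≋ (λ k → ∑-δ j (Y k))
      transposed : ∑[ k < m ] ∑[ l < m ] (δ i l × (δ j k × Y k l)) ≈ Y j i
      transposed = trans (sum-cong-≋ (λ k → ∑-δ i (λ l → δ j k × Y k l))) (∑-δ j (λ k → Y k i))

    ∑∑-1+δδ : ∀ (Y : Fin m → Fin m → Carrier) i j →
      ∑[ k < m ] ∑[ l < m ] ((1 ℕ.+ δ j l ℕ.* δ i k) × Y k l) ≈ total Y + Y i j
    ∑∑-1+δδ Y i j = begin
      ∑[ k < m ] ∑[ l < m ] ((1 ℕ.+ δ j l ℕ.* δ i k) × Y k l)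
        ≈⟨ sum-cong-≋ (λ k → sum-cong-≋ (λ l → +-congˡ (sym (×-assocˡ (Y k l) (δ j l) (δ i k))))) ⟩
      ∑[ k < m ] ∑[ l < m ] (Y k l + δ j l × (δ i k × Y k l))
        ≈⟨ ∑∑-distrib-+ Y (λ k l → δ j l × (δ i k × Y k l)) ⟩
      total Y + ∑[ k < m ] ∑[ l < m ] (δ j l × (δ i k × Y k l))
        ≈⟨ +-congˡ (trans (sum-cong-≋ (λ k → ∑-δ j (λ l → δ i k × Y k l))) (∑-δ i (λ k → Y k j))) ⟩
      total Y + Y i j ∎

    -- y is kept apart from Y i j: a vertex carries a proof of i ≢ j, and the
    -- eigenvector need not ignore it.
    PairRelation : Carrier → (Fin m → Fin m → Carrier) → Carrier → Fin m → Fin m → Set ℓ₁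
    PairRelation λ′ Y y i j = λ′ * y + rowSum Y i + colSum Y j + Y j i ≈ total Y + Y i j

    PairEquation : Carrier → (Fin m → Fin m → Carrier) → Set ℓ₁
    PairEquation λ′ Y = ∀ {i j} → i ≢ j → PairRelation λ′ Y (Y i j) i j

    ZeroDiagonal : (Fin m → Fin m → Carrier) → Set ℓ₁
    ZeroDiagonal Y = ∀ i → Y i i ≈ 0#

    pairEquation-transpose : ∀ {λ′ Y} → PairEquation λ′ Y → PairEquation λ′ (transpose Y)
    pairEquation-transpose {λ′} {Y} eq {i} {j} i≢j = begin
      λ′ * Y j i + colSum Y i + rowSum Y j + Y i j
        ≈⟨ solve 4 (λ a b c d → ((a ⊕ b) ⊕ c) ⊕ d ⊜ ((a ⊕ c) ⊕ b) ⊕ d) refl _ _ _ _ ⟩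
      λ′ * Y j i + rowSum Y j + colSum Y i + Y i j
        ≈⟨ eq (i≢j ∘ ≡.sym) ⟩
      total Y + Y j i
        ≈⟨ +-congʳ (total-transpose Y) ⟨
      total (transpose Y) + Y j i ∎

    module _ {λ′ : Carrier} {Y : Fin m → Fin m → Carrier}
             (diag : ZeroDiagonal Y) (eq : PairEquation λ′ Y) where

      pairEquation-withDiagonal : ∀ i j →
        λ′ * Y i j + rowSum Y i + colSum Y j + Y j i + δ i j × total Y
          ≈ total Y + Y i j + δ i j × (rowSum Y i + colSum Y j)
      pairEquation-withDiagonal i j with i ≟ j
      ... | no i≢j     = +-congʳ (eq i≢j)
      ... | yes ≡.refl = begin
        λ′ * Y i i + R + C + Y i i + (S + 0#)
          ≈⟨ +-congʳ (+-cong (+-congʳ (+-congʳ (trans (*-congˡ (diag i)) (zeroʳ λ′)))) (diag i)) ⟩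
        0# + R + C + 0# + (S + 0#)
          ≈⟨ solve 3 (λ r c s → (((id ⊕ r) ⊕ c) ⊕ id) ⊕ (s ⊕ id) ⊜ (s ⊕ id) ⊕ ((r ⊕ c) ⊕ id)) refl R C S ⟩
        S + 0# + (R + C + 0#)
          ≈⟨ +-congʳ (+-congˡ (diag i)) ⟨
        S + Y i i + (R + C + 0#) ∎
        where
        R C S : Carrier
        R = rowSum Y i
        C = colSum Y i
        S = total Y

      pairEquation-summed : ∀ i →
        λ′ * rowSum Y i + m × rowSum Y i + total Y + colSum Y i + total Y
          ≈ m × total Y + rowSum Y i + (rowSum Y i + colSum Y i)
      pairEquation-summed i = begin
        λ′ * R i + m × R i + S + C i + S
          ≈⟨ +-cong (+-cong (+-cong (+-cong (*-distribˡ-sum λ′ (Y i)) (sym (sum-replicate m))) (∑-comm Y)) refl)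
                    (sym (∑-δ i (λ _ → S))) ⟩
        ∑[ j < m ] t₁ j + ∑[ j < m ] t₂ j + ∑[ j < m ] t₃ j + ∑[ j < m ] t₄ j + ∑[ j < m ] t₅ j
          ≈⟨ ∑-distrib-+₅ ⟨
        ∑[ j < m ] (t₁ j + t₂ j + t₃ j + t₄ j + t₅ j)
          ≈⟨ sum-cong-≋ (pairEquation-withDiagonal i) ⟩
        ∑[ j < m ] (S + Y i j + t₆ j)
          ≈⟨ trans (∑-distrib-+ (λ j → S + Y i j) t₆) (+-congʳ (∑-distrib-+ (λ _ → S) (Y i))) ⟩
        ∑[ j < m ] S + R i + ∑[ j < m ] t₆ j
          ≈⟨ +-cong (+-congʳ (sum-replicate m)) (∑-δ i (λ j → R i + C j)) ⟩
        m × S + R i + (R i + C i) ∎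
        where
        R C : Fin m → Carrier
        R = rowSum Y
        C = colSum Y
        S : Carrier
        S = total Y
        t₁ t₂ t₃ t₄ t₅ t₆ : Fin m → Carrier
        t₁ j = λ′ * Y i j
        t₂ _ = R i
        t₃ j = C j
        t₄ j = Y j i
        t₅ j = δ i j × S
        t₆ j = δ i j × (R i + C j)
        ∑-distrib-+₅ : ∑[ j < m ] (t₁ j + t₂ j + t₃ j + t₄ j + t₅ j)
          ≈ ∑[ j < m ] t₁ j + ∑[ j < m ] t₂ j + ∑[ j < m ] t₃ j + ∑[ j < m ] t₄ j + ∑[ j < m ] t₅ j
        ∑-distrib-+₅ =
          trans (∑-distrib-+ (λ j → t₁ j + t₂ j + t₃ j + t₄ j) t₅) (+-congʳ (
          trans (∑-distrib-+ (λ j → t₁ j + t₂ j + t₃ j) t₄) (+-congʳ (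
          trans (∑-distrib-+ (λ j → t₁ j + t₂ j) t₃) (+-congʳ (∑-distrib-+ t₁ t₂))))))

  module _ {n : ℕ} {λ′ : Carrier} {Y : Fin (2 ℕ.+ n) → Fin (2 ℕ.+ n) → Carrier}
           (diag : ZeroDiagonal Y) (eq : PairEquation λ′ Y) where

    pairEquation-rowSum : ∀ i → (λ′ + fromℕ F n) * rowSum Y i ≈ fromℕ F n * total Y
    pairEquation-rowSum i = begin
      (λ′ + fromℕ F n) * R    ≈⟨ distribʳ R λ′ (fromℕ F n) ⟩
      λ′ * R + fromℕ F n * R  ≈⟨ +-congˡ (fromℕ-*ˡ n R) ⟩
      λ′ * R + n × R          ≈⟨ +-cancelʳ T _ _ cancelled ⟩
      n × S                   ≈⟨ fromℕ-*ˡ n S ⟨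
      fromℕ F n * S           ∎
      where
      R C S T : Carrier
      R = rowSum Y i
      C = colSum Y i
      S = total Y
      T = R + R + (S + S) + C
      cancelled : λ′ * R + n × R + T ≈ n × S + T
      cancelled = begin
        λ′ * R + n × R + T
          ≈⟨ solve 5 (λ a b r s c → (a ⊕ b) ⊕ (((r ⊕ r) ⊕ (s ⊕ s)) ⊕ c) ⊜ (((a ⊕ (r ⊕ (r ⊕ b))) ⊕ s) ⊕ c) ⊕ s)
                     refl (λ′ * R) (n × R) R S C ⟩
        λ′ * R + (R + (R + n × R)) + S + C + S
          ≈⟨ pairEquation-summed diag eq i ⟩
        S + (S + n × S) + R + (R + C)
          ≈⟨ solve 4 (λ b r s c → ((s ⊕ (s ⊕ b)) ⊕ r) ⊕ (r ⊕ c) ⊜ b ⊕ (((r ⊕ r) ⊕ (s ⊕ s)) ⊕ c))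
                     refl (n × S) R S C ⟩
        n × S + T ∎

  module _ {n : ℕ} {λ′ : Carrier} {Y : Fin (2 ℕ.+ n) → Fin (2 ℕ.+ n) → Carrier}
           (diag : ZeroDiagonal Y) (eq : PairEquation λ′ Y) where

    pairEquation-colSum : ∀ j → (λ′ + fromℕ F n) * colSum Y j ≈ fromℕ F n * total Y
    pairEquation-colSum j =
      trans (pairEquation-rowSum diag (pairEquation-transpose eq) j) (*-congˡ (total-transpose Y))

    pairEquation-total : (λ′ + fromℕ F n) * total Y ≈ (fromℕ F (2 ℕ.+ n) * fromℕ F n) * total Y
    pairEquation-total = begin
      (λ′ + fromℕ F n) * total Y                         ≈⟨ *-distribˡ-sum (λ′ + fromℕ F n) (rowSum Y) ⟩
      ∑[ i < 2 ℕ.+ n ] ((λ′ + fromℕ F n) * rowSum Y i)   ≈⟨ sum-cong-≋ (pairEquation-rowSum diag eq) ⟩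
      ∑[ i < 2 ℕ.+ n ] (fromℕ F n * total Y)             ≈⟨ sum-replicate (2 ℕ.+ n) ⟩
      (2 ℕ.+ n) × (fromℕ F n * total Y)                  ≈⟨ fromℕ-*ˡ (2 ℕ.+ n) _ ⟨
      fromℕ F (2 ℕ.+ n) * (fromℕ F n * total Y)          ≈⟨ *-assoc _ _ _ ⟨
      (fromℕ F (2 ℕ.+ n) * fromℕ F n) * total Y          ∎

  λp+q≈p∧λq+p≈q⇒p≈0 : ∀ {λ′ p q} → ¬ λ′ ≈ 0# → ¬ λ′ ≈ 1# + 1# →
                       λ′ * p + q ≈ p → λ′ * q + p ≈ q → p ≈ 0#
  λp+q≈p∧λq+p≈q⇒p≈0 {λ′} {p} {q} λ′≉0 λ′≉2 λp+q≈p λq+p≈q = x≉y∧xz≈yz⇒z≈0 λ′≉2 λp≈2p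
    where
    λ[p+q]≈0[p+q] : λ′ * (p + q) ≈ 0# * (p + q)
    λ[p+q]≈0[p+q] = trans (+-cancelʳ (p + q) _ _ (begin
      λ′ * (p + q) + (p + q)       ≈⟨ +-congʳ (distribˡ λ′ p q) ⟩
      λ′ * p + λ′ * q + (p + q)    ≈⟨ solve 4 (λ a b x y → (a ⊕ b) ⊕ (x ⊕ y) ⊜ (a ⊕ y) ⊕ (b ⊕ x))
                                              refl (λ′ * p) (λ′ * q) p q ⟩
      (λ′ * p + q) + (λ′ * q + p)  ≈⟨ +-cong λp+q≈p λq+p≈q ⟩
      p + q                        ≈⟨ +-identityˡ (p + q) ⟨
      0# + (p + q)                 ∎)) (sym (zeroˡ (p + q)))
    q+p≈0 : q + p ≈ 0#
    q+p≈0 = trans (+-comm q p) (x≉y∧xz≈yz⇒z≈0 λ′≉0 λ[p+q]≈0[p+q])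
    λp≈2p : λ′ * p ≈ (1# + 1#) * p
    λp≈2p = begin
      λ′ * p             ≈⟨ +-identityʳ (λ′ * p) ⟨
      λ′ * p + 0#        ≈⟨ +-congˡ q+p≈0 ⟨
      λ′ * p + (q + p)   ≈⟨ +-assoc (λ′ * p) q p ⟨
      λ′ * p + q + p     ≈⟨ +-congʳ λp+q≈p ⟩
      p + p              ≈⟨ +-cong (*-identityˡ p) (*-identityˡ p) ⟨
      1# * p + 1# * p    ≈⟨ distribʳ p 1# 1# ⟨
      (1# + 1#) * p      ∎

  pairRelation-scale : ∀ {m λ′ μ y} {Y : Fin m → Fin m → Carrier} {i j} →
    μ * rowSum Y i ≈ 0# → μ * colSum Y j ≈ 0# → μ * total Y ≈ 0# →
    PairRelation λ′ Y y i j → λ′ * (μ * y) + μ * Y j i ≈ μ * Y i j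
  pairRelation-scale {λ′ = λ′} {μ} {y} {Y} {i} {j} μR≈0 μC≈0 μS≈0 rel = begin
    λ′ * (μ * y) + μ * Y j i
      ≈⟨ +-congʳ (trans (sym (*-assoc λ′ μ y)) (trans (*-congʳ (*-comm λ′ μ)) (*-assoc μ λ′ y))) ⟩
    μ * (λ′ * y) + μ * Y j i
      ≈⟨ +-congʳ (trans (sym (+-identityʳ _)) (+-cong (sym (+-identityʳ _)) (sym μC≈0))) ⟩
    μ * (λ′ * y) + 0# + μ * colSum Y j + μ * Y j i
      ≈⟨ +-congʳ (+-congʳ (+-congˡ μR≈0)) ⟨
    μ * (λ′ * y) + μ * rowSum Y i + μ * colSum Y j + μ * Y j i
      ≈⟨ trans (distribˡ μ _ _) (+-congʳ (trans (distribˡ μ _ _) (+-congʳ (distribˡ μ _ _)))) ⟨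
    μ * (λ′ * y + rowSum Y i + colSum Y j + Y j i)
      ≈⟨ *-congˡ rel ⟩
    μ * (total Y + Y i j)
      ≈⟨ distribˡ μ (total Y) (Y i j) ⟩
    μ * total Y + μ * Y i j
      ≈⟨ trans (+-congʳ μS≈0) (+-identityˡ _) ⟩
    μ * Y i j ∎

  module _ {k : ℕ} {λ′ : Carrier} {Y : Fin (3 ℕ.+ k) → Fin (3 ℕ.+ k) → Carrier}
           (diag : ZeroDiagonal Y) (eq : PairEquation λ′ Y)
           (μ≤0 : (λ′ + fromℕ F (suc k)) ≤ 0#) where

    private
      ĉ μ : Carrier
      ĉ = fromℕ F (suc k)
      μ = λ′ + ĉ

      μ≉1+ : ∀ {z} → 0# ≤ z → ¬ μ ≈ 1# + z
      μ≉1+ = x≤0∧0≤y⇒x≉1+y μ≤0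

      λ′≉0 : ¬ λ′ ≈ 0#
      λ′≉0 λ′≈0 = μ≉1+ (0≤fromℕ k) (trans (+-congʳ λ′≈0) (+-identityˡ ĉ))

      λ′≉2 : ¬ λ′ ≈ 1# + 1#
      λ′≉2 λ′≈2 = μ≉1+ (0≤fromℕ (suc (suc k))) (trans (+-congʳ λ′≈2) (+-assoc 1# 1# ĉ))

      μ≉[3+k]ĉ : ¬ μ ≈ fromℕ F (3 ℕ.+ k) * ĉ
      -- (3 + k) * suc k reduces to a successor, so its image is 1# + something.
      μ≉[3+k]ĉ μ≈[3+k]ĉ = μ≉1+ (0≤fromℕ (ℕ.pred ((3 ℕ.+ k) ℕ.* suc k)))
                                (trans μ≈[3+k]ĉ (sym (fromℕ-homo-* (3 ℕ.+ k) (suc k))))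

      total≈0 : total Y ≈ 0#
      total≈0 = x≉y∧xz≈yz⇒z≈0 μ≉[3+k]ĉ (pairEquation-total diag eq)

      μz≈ĉS⇒μz≈0 : ∀ {z} → μ * z ≈ ĉ * total Y → μ * z ≈ 0#
      μz≈ĉS⇒μz≈0 μz≈ĉS = trans μz≈ĉS (trans (*-congˡ total≈0) (zeroʳ ĉ))

      scaled : ∀ {y i j} → PairRelation λ′ Y y i j → λ′ * (μ * y) + μ * Y j i ≈ μ * Y i j
      scaled {i = i} {j} = pairRelation-scale {Y = Y}
        (μz≈ĉS⇒μz≈0 (pairEquation-rowSum diag eq i)) (μz≈ĉS⇒μz≈0 (pairEquation-colSum diag eq j))
        (trans (*-congˡ total≈0) (zeroʳ μ))

      μY≈0 : ∀ {i j} → i ≢ j → μ * Y i j ≈ 0#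
      μY≈0 i≢j = λp+q≈p∧λq+p≈q⇒p≈0 λ′≉0 λ′≉2 (scaled (eq i≢j)) (scaled (eq (i≢j ∘ ≡.sym)))

    pairRelation⇒λ+c≈0 : ∀ {y i j} → i ≢ j → ¬ y ≈ 0# → PairRelation λ′ Y y i j →
      λ′ + fromℕ F (suc k) ≈ 0#
    pairRelation⇒λ+c≈0 {y} {i} {j} i≢j y≉0 rel =
      x≉y∧xz≈yz⇒z≈0 y≉0 (trans (*-comm y μ) (trans μy≈0 (sym (zeroˡ μ))))
      where
      λμy≈0μy : λ′ * (μ * y) ≈ 0# * (μ * y)
      λμy≈0μy = begin
        λ′ * (μ * y)              ≈⟨ +-identityʳ _ ⟨
        λ′ * (μ * y) + 0#         ≈⟨ +-congˡ (μY≈0 (i≢j ∘ ≡.sym)) ⟨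
        λ′ * (μ * y) + μ * Y j i  ≈⟨ scaled rel ⟩
        μ * Y i j                 ≈⟨ μY≈0 i≢j ⟩
        0#                        ≈⟨ zeroˡ (μ * y) ⟨
        0# * (μ * y)              ∎
      μy≈0 : μ * y ≈ 0#
      μy≈0 = x≉y∧xz≈yz⇒z≈0 λ′≉0 λμy≈0μy

  pairRelation⇒-c≤λ : ∀ {k λ′ y} {Y : Fin (3 ℕ.+ k) → Fin (3 ℕ.+ k) → Carrier} {i j} →
    ZeroDiagonal Y → PairEquation λ′ Y → i ≢ j → ¬ y ≈ 0# → PairRelation λ′ Y y i j →
    (- fromℕ F (suc k)) ≤ λ′
  pairRelation⇒-c≤λ {k} {λ′} diag eq i≢j y≉0 rel with ≤-total (- fromℕ F (suc k)) λ′
  ... | inj₁ -c≤λ′ = -c≤λ′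
  ... | inj₂ λ′≤-c = ≤-resp-≈ refl (sym λ′≈-c) ≤-refl
    where
    λ′+c≤0 : (λ′ + fromℕ F (suc k)) ≤ 0#
    λ′+c≤0 = ≤-resp-≈ refl (-‿inverseˡ _) (+-mono-≤ (fromℕ F (suc k)) λ′≤-c)
    λ′≈-c : λ′ ≈ - fromℕ F (suc k)
    λ′≈-c = +-inverseˡ-unique λ′ _ (pairRelation⇒λ+c≈0 diag eq λ′+c≤0 i≢j y≉0 rel)

  sumₗ : List Carrier → Carrier
  sumₗ = foldr _+_ 0#

  sumₗ-++ : ∀ xs ys → sumₗ (xs ++ ys) ≈ sumₗ xs + sumₗ ys
  sumₗ-++ []       ys = sym (+-identityˡ _)
  sumₗ-++ (x ∷ xs) ys = trans (+-congˡ (sumₗ-++ xs ys)) (sym (+-assoc _ _ _))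

  sumₗ-concatMap-tabulate : ∀ {A B : Set} {n} (f : B → Carrier) (G : A → List B) (g : Fin n → A) →
    sumₗ (map f (concatMap G (tabulate g))) ≈ ∑[ i < n ] sumₗ (map f (G (g i)))
  sumₗ-concatMap-tabulate {n = zero}  f G g = refl
  sumₗ-concatMap-tabulate {B = B} {suc n} f G g = begin
    sumₗ (map f (G (g Fin.zero) ++ rest))              ≡⟨ ≡.cong sumₗ (List.map-++ f (G (g Fin.zero)) rest) ⟩
    sumₗ (map f (G (g Fin.zero)) ++ map f rest)        ≈⟨ sumₗ-++ (map f (G (g Fin.zero))) (map f rest) ⟩
    sumₗ (map f (G (g Fin.zero))) + sumₗ (map f rest)  ≈⟨ +-congˡ (sumₗ-concatMap-tabulate f G (g ∘ Fin.suc)) ⟩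
    ∑[ i < suc n ] sumₗ (map f (G (g i)))             ∎
    where
    rest : List B
    rest = concatMap G (tabulate (g ∘ Fin.suc))

  sumₗ-mapMaybe-tabulate : ∀ {A B : Set} {n} (f : B → Carrier) (p : A → Maybe B) (g : Fin n → A) →
    sumₗ (map f (mapMaybe p (tabulate g))) ≈ ∑[ i < n ] maybe′ f 0# (p (g i))
  sumₗ-mapMaybe-tabulate {n = zero}  f p g = refl
  sumₗ-mapMaybe-tabulate {n = suc n} f p g with p (g Fin.zero)
  ... | just _  = +-congˡ (sumₗ-mapMaybe-tabulate f p (g ∘ Fin.suc))
  ... | nothing = trans (sumₗ-mapMaybe-tabulate f p (g ∘ Fin.suc)) (sym (+-identityˡ _))

  toMatrix : ∀ {m} → (Vertex m → Carrier) → Fin m → Fin m → Carrier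
  toMatrix f i j with i ≟ j
  ... | yes _   = 0#
  ... | no i≢j  = f ((i , j) , i≢j)

  toMatrix-zeroDiagonal : ∀ {m} (f : Vertex m → Carrier) → ZeroDiagonal (toMatrix f)
  toMatrix-zeroDiagonal f i with i ≟ i
  ... | yes _   = refl
  ... | no i≢i  = ⊥-elim (i≢i ≡.refl)

  toMatrix-offDiagonal : ∀ {m} (f : Vertex m → Carrier) {i j} → i ≢ j →
    Σ[ i≢j ∈ i ≢ j ] toMatrix f i j ≈ f ((i , j) , i≢j)
  toMatrix-offDiagonal f {i} {j} i≢j with i ≟ j
  ... | yes i≡j  = ⊥-elim (i≢j i≡j)
  ... | no i≢j′  = i≢j′ , refl

  maybe-select≈toMatrix : ∀ {m} (f : Vertex m → Carrier) i j → maybe′ f 0# (select m i j) ≈ toMatrix f i j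
  maybe-select≈toMatrix f i j with i ≟ j
  ... | yes _ = refl
  ... | no _  = refl

  sumV≈∑∑toMatrix : ∀ m (f : Vertex m → Carrier) → sumV F m f ≈ ∑[ i < m ] ∑[ j < m ] toMatrix f i j
  sumV≈∑∑toMatrix m f =
    trans (sumₗ-concatMap-tabulate f (λ i → mapMaybe (select m i) (allFin m)) (λ i → i))
          (sum-cong-≋ (λ i → trans (sumₗ-mapMaybe-tabulate f (select m i) (λ j → j))
                                   (sum-cong-≋ (maybe-select≈toMatrix f i))))

  adjMatrix*≈adjacency× : ∀ {m} (u v : Vertex m) y → adjMatrix F u v * y ≈ adjacency u v × y
  adjMatrix*≈adjacency× u v y with adjacent? u v
  ... | yes _ = trans (*-identityˡ y) (sym (+-identityʳ y))
  ... | no _  = zeroˡ y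

  module _ {m : ℕ} {λ′ : Carrier} {x : Vertex m → Carrier}
           (eig : ∀ u → sumV F m (λ v → adjMatrix F u v * x v) ≈ λ′ * x u) where

    eigenvector-pairRelation : ∀ {i j} (i≢j : i ≢ j) → PairRelation λ′ (toMatrix x) (x ((i , j) , i≢j)) i j
    eigenvector-pairRelation {i} {j} i≢j = begin
      λ′ * x u + rowSum X i + colSum X j + X j i
        ≈⟨ solve 4 (λ a b c d → ((a ⊕ b) ⊕ c) ⊕ d ⊜ a ⊕ ((b ⊕ c) ⊕ d)) refl _ _ _ _ ⟩
      λ′ * x u + (rowSum X i + colSum X j + X j i)
        ≈⟨ +-cong (trans (sym (eig u)) (sumV≈∑∑toMatrix m _)) (sym (∑∑-δ+δ+δδ X i j)) ⟩
      ∑[ k < m ] ∑[ l < m ] A k l + ∑[ k < m ] ∑[ l < m ] (w k l × X k l)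
        ≈⟨ ∑∑-distrib-+ A (λ k l → w k l × X k l) ⟨
      ∑[ k < m ] ∑[ l < m ] (A k l + w k l × X k l)
        ≈⟨ sum-cong-≋ (λ k → sum-cong-≋ (λ l → entrywise k l)) ⟩
      ∑[ k < m ] ∑[ l < m ] (w′ k l × X k l)
        ≈⟨ ∑∑-1+δδ X i j ⟩
      total X + X i j ∎
      where
      u : Vertex m
      u = (i , j) , i≢j
      X A : Fin m → Fin m → Carrier
      X = toMatrix x
      A = toMatrix (λ v → adjMatrix F u v * x v)
      w w′ : Fin m → Fin m → ℕ
      w k l = δ i k ℕ.+ δ j l ℕ.+ δ i l ℕ.* δ j k
      w′ k l = 1 ℕ.+ δ j l ℕ.* δ i k
      entrywise : ∀ k l → A k l + w k l × X k l ≈ w′ k l × X k l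
      entrywise k l with k ≟ l
      ... | yes _ = trans (+-identityˡ _) (trans (×-zeroʳ (w k l)) (sym (×-zeroʳ (w′ k l))))
      ... | no k≢l = begin
        adjMatrix F u v * x v + w k l × x v  ≈⟨ +-congʳ (adjMatrix*≈adjacency× u v (x v)) ⟩
        adjacency u v × x v + w k l × x v    ≈⟨ ×-homo-+ (x v) (adjacency u v) (w k l) ⟨
        (adjacency u v ℕ.+ w k l) × x v      ≈⟨ ×-congˡ (adjacency+δ+δ+δδ≡1+δδ i≢j k≢l) ⟩
        w′ k l × x v                         ∎
        where
        v : Vertex m
        v = (k , l) , k≢l

    eigenvector-pairEquation : PairEquation λ′ (toMatrix x)
    eigenvector-pairEquation i≢j with toMatrix-offDiagonal x i≢j
    ... | i≢j′ , Xij≈xu = trans (+-congʳ (+-congʳ (+-congʳ (*-congˡ Xij≈xu)))) (eigenvector-pairRelation i≢j′)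

lemma2p18 : ∀ {c ℓ₁ ℓ₂} (F : OrderedField c ℓ₁ ℓ₂) (n : ℕ) → 3 < n →
    ∀ (λ′ : OrderedField.Carrier F) → IsAdjEigenvalue F (n ∸ 1) λ′ →
    OrderedField._≤_ F (OrderedField.-_ F (fromℕ F (n ∸ 3))) λ′
lemma2p18 F _ (s≤s (s≤s (s≤s (s≤s _)))) λ′ (x , (((i , j) , i≢j) , xu≉0) , eig) =
  pairRelation⇒-c≤λ F (toMatrix-zeroDiagonal F x) (eigenvector-pairEquation F eig) i≢j xu≉0
    (eigenvector-pairRelation F eig i≢j)
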